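{- The probabilistic function $\mathit{I2P}$ is probabilistic recursive, i.e. belongs to $\mathscr{PR}$.
   Context: A pseudodistribution on $\mathbb{N}$ is $\mathcal{D}:\mathbb{N}\to[0,1]$ with $\sum_n\mathcal{D}(n)\le1$; a probabilistic function (PF) is a map $\mathbb{N}^k\to\mathbb{D}(\mathbb{N})$. $\mathscr{PR}$ is the smallest class of PFs containing: zero $z(n)(0)=1$; successor $s(n)(n+1)=1$; projections $\Pi^n_m(k_1,\dots,k_n)(k_m)=1$; fair coin $r(x)(x)=r(x)(x+1)=1/2$ (other values $0$); and closed under generalized composition $(f\odot(g_1,\dots,g_n))(\vec x)(y)=\sum_{z_1,\dots,z_n}f(\vec z)(y)\prod_i g_i(\vec x)(z_i)$, primitive recursion $h(\vec x,0)=f(\vec x)$, $h(\vec x,y+1)(w)=\sum_z h(\vec x,y)(z)g(\vec x,y,z)(w)$, and minimization $\mu f(\vec x)(y)=f(\vec x,y)(0)\prod_{z<y}\sum_{k>0}f(\vec x,z)(k)$. Rational numbers are encoded as natural numbers via pairs (numerator, denominator) using a computable bijection $\mathit{pair}:\mathbb{N}\times\mathbb{N}\to\mathbb{N}$ with computable inverse. $\mathit{I2P}:\mathbb{Q}\to\mathbb{D}(\mathbb{N})$ (inputs under this encoding) is defined by $\mathit{I2P}(x)(1)=x$ and $\mathit{I2P}(x)(0)=1-x$ when $0\le x\le1$, and $\mathit{I2P}(x)(y)=0$ in all other cases. -}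

module Defs where

open import Data.Nat as ℕ using (ℕ; zero; suc; _≤ᵇ_)
open import Data.Nat.DivMod using () renaming (_/_ to _div_)
open import Data.Bool using (Bool; true; false; if_then_else_)
open import Data.Fin using (Fin)
open import Data.Vec using (Vec; []; _∷_; _∷ʳ_; lookup; init; last)
open import Data.Integer using (+_)
open import Data.Rational using (ℚ; 0ℚ; 1ℚ; ½; _+_; _*_; _-_; _/_; _≤_; _<_)
open import Data.Product using (_×_; ∃)

-- Syntax of the class PR: PR k = PR-terms of arity k (maps ℕ^k → 𝔻(ℕ)).
data PR : ℕ → Set where
  zeroF : PR 1
  succF : PR 1
  proj  : (n : ℕ) → Fin n → PR n
  coin  : PR 1
  comp  : ∀ {n k} → PR n → Vec (PR k) n → PR k
  rec   : ∀ {k} → PR k → PR (suc (suc k)) → PR (suc k)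
                                                -- h(x⃗,0)=f(x⃗), h(x⃗,y+1) via g(x⃗,y,z)
  mu    : ∀ {k} → PR (suc k) → PR k

Σ< : ℕ → (ℕ → ℚ) → ℚ
Σ< zero    f = 0ℚ
Σ< (suc n) f = Σ< n f + f n

Π< : ℕ → (ℕ → ℚ) → ℚ
Π< zero    f = 1ℚ
Π< (suc n) f = Π< n f * f n

sumVec : ∀ {m} → ℕ → Vec (ℕ → ℚ) m → (Vec ℕ m → ℚ) → ℚ
sumVec n []       F = F []
sumVec n (d ∷ ds) F = Σ< n (λ z → d z * sumVec n ds (λ zs → F (z ∷ zs)))

eqℕ : ℕ → ℕ → Bool
eqℕ a b = (a ≤ᵇ b) Data.Bool.∧ (b ≤ᵇ a)

δ : ℕ → ℕ → ℚ
δ a b = if eqℕ a b then 1ℚ else 0ℚ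

recIter : ∀ {k} → ℕ → (Vec ℕ k → ℕ → ℚ) → (Vec ℕ (suc (suc k)) → ℕ → ℚ)
        → Vec ℕ k → ℕ → ℕ → ℚ
recIter n f g xs zero    w = f xs w
recIter n f g xs (suc y) w =
  Σ< n (λ z → recIter n f g xs y z * g ((xs ∷ʳ y) ∷ʳ z) w)

-- Stage-n approximation of the semantics: all infinite sums Σ_{z∈ℕ} are
-- truncated to Σ_{z<n}.  These approximations are nonnegative and
-- nondecreasing in n, and (monotone convergence) their supremum is the
-- value of the probabilistic function defined in the paper.
mutual
  ⟦_⟧ : ∀ {k} → PR k → ℕ → Vec ℕ k → ℕ → ℚ
  ⟦ zeroF ⟧    n xs y = δ y 0
  ⟦ succF ⟧    n (x ∷ []) y = δ y (suc x)
  ⟦ proj _ m ⟧ n xs y = δ y (lookup xs m)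
  ⟦ coin ⟧     n (x ∷ []) y =
    if eqℕ y x then ½ else (if eqℕ y (suc x) then ½ else 0ℚ)
  ⟦ comp f gs ⟧ n xs y = sumVec n (⟦ gs ⟧* n xs) (λ zs → ⟦ f ⟧ n zs y)
  ⟦ rec f g ⟧  n xs y = recIter n (⟦ f ⟧ n) (⟦ g ⟧ n) (init xs) (last xs) y
  ⟦ mu f ⟧     n xs y =
    ⟦ f ⟧ n (xs ∷ʳ y) 0 * Π< y (λ z → Σ< n (λ j → ⟦ f ⟧ n (xs ∷ʳ z) (suc j)))

  ⟦_⟧* : ∀ {k m} → Vec (PR k) m → ℕ → Vec ℕ k → Vec (ℕ → ℚ) m
  ⟦ [] ⟧*     n xs = []
  ⟦ g ∷ gs ⟧* n xs = (λ y → ⟦ g ⟧ n xs y) ∷ ⟦ gs ⟧* n xs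

SupIs : (ℕ → ℚ) → ℚ → Set
SupIs a q = (∀ n → a n ≤ q) × (∀ ε → 0ℚ < ε → ∃ λ n → q - ε < a n)

_⟨_,_⟩≈_ : ∀ {k} → PR k → Vec ℕ k → ℕ → ℚ → Set
t ⟨ xs , y ⟩≈ q = SupIs (λ n → ⟦ t ⟧ n xs y) q

-- Cantor pairing bijection ℕ × ℕ → ℕ
pair : ℕ → ℕ → ℕ
pair a b = ((a ℕ.+ b) ℕ.* suc (a ℕ.+ b)) div 2 ℕ.+ b

-- I2P applied to the code pair(a,b) of the fraction a/b
I2P : ℕ → ℕ → ℕ → ℚ
I2P a zero      y = 0ℚ
I2P a (suc b)   y =
  if a ≤ᵇ suc b
  then (if eqℕ y 1 then (+ a) / suc b
        else if eqℕ y 0 then 1ℚ - (+ a) / suc b else 0ℚ)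
  else 0ℚ

-- I2P (a / b) is realised by drawing i with probability 2^-(i+1), as the first 0 of a fair
-- coin (μ), and returning the i-th binary digit of a / b, computed by long division from the
-- decoded pair; the probability of 1 is then Σᵢ 2^-(i+1) dᵢ = a / b. When a / b is not a
-- probability the coin is flipped at a nonzero "defect", never shows 0, and μ yields the
-- zero pseudodistribution. At stage n a deterministic subterm is either 0 or the exact point
-- mass, and exact from some stage on, so each stage is a partial sum of the series with some
-- terms dropped: it never exceeds the sum and eventually exceeds every partial sum.

module Submission where

open import Defs
open import Data.Nat using (ℕ)
open import Data.Vec using ([]; _∷_)
open import Data.Product using (Σ)

open import Data.Bool using (true; false)
open import Data.Empty using (⊥-elim)
open import Data.Fin using (Fin; #_)
open import Data.Integer as ℤ using (+_; +[1+_]; -[1+_]; +0)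
import Data.Integer.Properties as ℤ
open import Data.Nat as ℕ using (zero; suc; z≤n; s≤s; _≤ᵇ_)
import Data.Nat.DivMod as ℕ
import Data.Nat.Properties as ℕ
import Data.Nat.Solver as ℕ-Solver
open import Data.Product using (_×_; _,_; ∃; proj₁; proj₂)
open import Data.Rational as ℚ using (ℚ; mkℚ; 0ℚ; 1ℚ; ½; _+_; _*_; _-_; -_; _≤_; _<_; toℚᵘ; nonNegative)
import Data.Rational.Properties as ℚ
open import Data.Rational.Solver using (module +-*-Solver)
open import Data.Rational.Unnormalised as ℚᵘ using (mkℚᵘ; *≡*)
import Data.Rational.Unnormalised.Properties as ℚᵘ
open import Data.Sum using (_⊎_; inj₁; inj₂; [_,_]′)
open import Data.Vec using (Vec; _∷ʳ_; lookup; init; last; initLast; map)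
open import Data.Vec.Relation.Binary.Pointwise.Inductive using (Pointwise; []; _∷_)
open import Function using (_$_; _∘_; id; const)
open import Relation.Binary.PropositionalEquality
open import Relation.Nullary using (yes; no; ofʸ; ofⁿ)

private
  variable
    k m : ℕ
    P Q : ℕ → Set

dirac : ℕ → ℕ → ℚ
dirac v y = δ y v

δ-refl : ∀ x → δ x x ≡ 1ℚ
δ-refl x with x ≤ᵇ x | ℕ.≤ᵇ-reflects-≤ x x
... | true  | _       = refl
... | false | ofⁿ x≰x = ⊥-elim (x≰x ℕ.≤-refl)

δ-≢ : ∀ {x y} → x ≢ y → δ x y ≡ 0ℚ
δ-≢ {x} {y} x≢y with x ≤ᵇ y | ℕ.≤ᵇ-reflects-≤ x y | y ≤ᵇ x | ℕ.≤ᵇ-reflects-≤ y x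
... | false | _       | _     | _       = refl
... | true  | _       | false | _       = refl
... | true  | ofʸ x≤y | true  | ofʸ y≤x = ⊥-elim (x≢y (ℕ.≤-antisym x≤y y≤x))

0≤1 : 0ℚ ≤ 1ℚ
0≤1 = ℚ.*≤* (ℤ.+≤+ z≤n)

δ-nonneg : ∀ x y → 0ℚ ≤ δ x y
δ-nonneg x y with eqℕ x y
... | true  = 0≤1
... | false = ℚ.≤-refl

x≡0⇒x*y≡0 : ∀ {x} y → x ≡ 0ℚ → x * y ≡ 0ℚ
x≡0⇒x*y≡0 y refl = ℚ.*-zeroˡ y

ZeroOr : ℚ → ℚ → Set
ZeroOr x t = x ≡ 0ℚ ⊎ x ≡ t

ZeroOr-trans : ∀ {x s t} → ZeroOr x s → ZeroOr s t → ZeroOr x t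
ZeroOr-trans (inj₁ x≡0) _           = inj₁ x≡0
ZeroOr-trans (inj₂ x≡s) (inj₁ s≡0) = inj₁ (trans x≡s s≡0)
ZeroOr-trans (inj₂ x≡s) (inj₂ s≡t) = inj₂ (trans x≡s s≡t)

ZeroOr-* : ∀ {x y s t} → ZeroOr x s → ZeroOr y t → ZeroOr (x * y) (s * t)
ZeroOr-* {y = y} (inj₁ x≡0) _ = inj₁ (x≡0⇒x*y≡0 y x≡0)
ZeroOr-* {x = x} (inj₂ _) (inj₁ y≡0) = inj₁ (trans (cong (x *_) y≡0) (ℚ.*-zeroʳ x))
ZeroOr-* (inj₂ x≡s) (inj₂ y≡t) = inj₂ (cong₂ _*_ x≡s y≡t)

ZeroOr-bounds : ∀ {x t} → 0ℚ ≤ t → ZeroOr x t → 0ℚ ≤ x × x ≤ t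
ZeroOr-bounds 0≤t (inj₁ refl) = ℚ.≤-refl , 0≤t
ZeroOr-bounds 0≤t (inj₂ refl) = 0≤t , ℚ.≤-refl

ZeroOrᶠ : (ℕ → ℚ) → (ℕ → ℚ) → Set
ZeroOrᶠ d e = d ≗ const 0ℚ ⊎ d ≗ e

ZeroOrᶠ-trans : ∀ {d e f} → ZeroOrᶠ d e → ZeroOrᶠ e f → ZeroOrᶠ d f
ZeroOrᶠ-trans (inj₁ d≗0) _           = inj₁ d≗0
ZeroOrᶠ-trans (inj₂ d≗e) (inj₁ e≗0) = inj₁ (λ y → trans (d≗e y) (e≗0 y))
ZeroOrᶠ-trans (inj₂ d≗e) (inj₂ e≗f) = inj₂ (λ y → trans (d≗e y) (e≗f y))

ZeroOrᶠ-at : ∀ {d e} → ZeroOrᶠ d e → ∀ y → ZeroOr (d y) (e y)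
ZeroOrᶠ-at (inj₁ d≗0) y = inj₁ (d≗0 y)
ZeroOrᶠ-at (inj₂ d≗e) y = inj₂ (d≗e y)

Eventually : (ℕ → Set) → Set
Eventually P = ∃ λ N → ∀ n → N ℕ.≤ n → P n

eventually-map : (∀ {n} → P n → Q n) → Eventually P → Eventually Q
eventually-map P⇒Q (N , P-from-N) = N , λ n N≤n → P⇒Q (P-from-N n N≤n)

eventually-× : Eventually P → Eventually Q → Eventually (λ n → P n × Q n)
eventually-× (M , P-from-M) (N , Q-from-N) = M ℕ.⊔ N , λ n M⊔N≤n →
  P-from-M n (ℕ.m⊔n≤o⇒m≤o M N M⊔N≤n) , Q-from-N n (ℕ.m⊔n≤o⇒n≤o M N M⊔N≤n)

eventually-≥ : ∀ c → Eventually (c ℕ.≤_)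
eventually-≥ c = c , λ _ c≤n → c≤n

eventually-∀< : {R : ℕ → ℕ → Set} → (∀ i → Eventually (R i)) → ∀ M → Eventually (λ n → ∀ i → i ℕ.< M → R i n)
eventually-∀< R-ev zero    = 0 , λ _ _ _ ()
eventually-∀< {R} R-ev (suc M) = eventually-map below-suc (eventually-× (eventually-∀< R-ev M) (R-ev M))
  where
  below-suc : ∀ {n} → (∀ i → i ℕ.< M → R i n) × R M n → ∀ i → i ℕ.< suc M → R i n
  below-suc (below , at) i i<1+M with ℕ.m<1+n⇒m<n∨m≡n i<1+M
  ... | inj₁ i<M  = below i i<M
  ... | inj₂ refl = at

-- Finite sums

Σ<-cong : ∀ n {f g : ℕ → ℚ} → (∀ i → i ℕ.< n → f i ≡ g i) → Σ< n f ≡ Σ< n g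
Σ<-cong zero    f≡g = refl
Σ<-cong (suc n) f≡g = cong₂ _+_ (Σ<-cong n (λ i i<n → f≡g i (ℕ.m<n⇒m<1+n i<n))) (f≡g n ℕ.≤-refl)

Σ<-vanishing : ∀ n {f : ℕ → ℚ} → (∀ i → i ℕ.< n → f i ≡ 0ℚ) → Σ< n f ≡ 0ℚ
Σ<-vanishing zero    f≡0 = refl
Σ<-vanishing (suc n) f≡0 = cong₂ _+_ (Σ<-vanishing n (λ i i<n → f≡0 i (ℕ.m<n⇒m<1+n i<n))) (f≡0 n ℕ.≤-refl)

Σ<-mono-≤ : ∀ n {f g : ℕ → ℚ} → (∀ i → f i ≤ g i) → Σ< n f ≤ Σ< n g
Σ<-mono-≤ zero    f≤g = ℚ.≤-refl
Σ<-mono-≤ (suc n) f≤g = ℚ.+-mono-≤ (Σ<-mono-≤ n f≤g) (f≤g n)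

Σ<-mono-length : ∀ {m n} {f : ℕ → ℚ} → (∀ i → 0ℚ ≤ f i) → m ℕ.≤ n → Σ< m f ≤ Σ< n f
Σ<-mono-length {n = zero}  0≤f z≤n = ℚ.≤-refl
Σ<-mono-length {n = suc n} {f} 0≤f m≤1+n with ℕ.m≤n⇒m<n∨m≡n m≤1+n
... | inj₂ refl  = ℚ.≤-refl
... | inj₁ m<1+n = begin
  _             ≤⟨ Σ<-mono-length 0≤f (ℕ.≤-pred m<1+n) ⟩
  Σ< n f        ≡⟨ ℚ.+-identityʳ (Σ< n f) ⟨
  Σ< n f + 0ℚ   ≤⟨ ℚ.+-monoʳ-≤ (Σ< n f) (0≤f n) ⟩
  Σ< n f + f n  ∎
  where open ℚ.≤-Reasoning

Π<-cong : ∀ n {f g : ℕ → ℚ} → (∀ i → i ℕ.< n → f i ≡ g i) → Π< n f ≡ Π< n g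
Π<-cong zero    f≡g = refl
Π<-cong (suc n) f≡g = cong₂ _*_ (Π<-cong n (λ i i<n → f≡g i (ℕ.m<n⇒m<1+n i<n))) (f≡g n ℕ.≤-refl)

Π<-ZeroOr : ∀ n {f g : ℕ → ℚ} → (∀ i → ZeroOr (f i) (g i)) → ZeroOr (Π< n f) (Π< n g)
Π<-ZeroOr zero    f∼g = inj₂ refl
Π<-ZeroOr (suc n) f∼g = ZeroOr-* (Π<-ZeroOr n f∼g) (f∼g n)

Σ<-dirac-beyond : ∀ n {v d} (h : ℕ → ℚ) → d ≗ dirac v → n ℕ.≤ v → Σ< n (λ z → d z * h z) ≡ 0ℚ
Σ<-dirac-beyond n {v} h d≗δ n≤v = Σ<-vanishing n λ i i<n →
  x≡0⇒x*y≡0 (h i) (trans (d≗δ i) (δ-≢ {i} {v} λ { refl → ℕ.<⇒≱ i<n n≤v }))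

Σ<-dirac : ∀ n {v d} (h : ℕ → ℚ) → d ≗ dirac v → v ℕ.< n → Σ< n (λ z → d z * h z) ≡ h v
Σ<-dirac (suc n) {v} {d} h d≗δ v<1+n with ℕ.m<1+n⇒m<n∨m≡n v<1+n
... | inj₁ v<n = begin
  Σ< n (λ z → d z * h z) + d n * h n  ≡⟨ cong₂ _+_ (Σ<-dirac n h d≗δ v<n) (x≡0⇒x*y≡0 (h n) dn≡0) ⟩
  h v + 0ℚ                            ≡⟨ ℚ.+-identityʳ (h v) ⟩
  h v                                 ∎
  where
  open ≡-Reasoning
  dn≡0 : d n ≡ 0ℚ
  dn≡0 = trans (d≗δ n) (δ-≢ {n} {v} λ { refl → ℕ.n≮n n v<n })
... | inj₂ refl = begin
  Σ< n (λ z → d z * h z) + d n * h n  ≡⟨ cong₂ _+_ (Σ<-dirac-beyond n h d≗δ ℕ.≤-refl) (cong (_* h n) dn≡1) ⟩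
  0ℚ + 1ℚ * h n                       ≡⟨ ℚ.+-identityˡ (1ℚ * h n) ⟩
  1ℚ * h n                            ≡⟨ ℚ.*-identityˡ (h n) ⟩
  h n                                 ∎
  where
  open ≡-Reasoning
  dn≡1 : d n ≡ 1ℚ
  dn≡1 = trans (d≗δ n) (δ-refl n)

Σ<-ZeroOrᶠ : ∀ n {v d} (h : ℕ → ℕ → ℚ) → ZeroOrᶠ d (dirac v) → ZeroOrᶠ (λ y → Σ< n (λ z → d z * h z y)) (h v)
Σ<-ZeroOrᶠ n h (inj₁ d≗0) = inj₁ λ y → Σ<-vanishing n λ i _ → x≡0⇒x*y≡0 (h i y) (d≗0 i)
Σ<-ZeroOrᶠ n {v} h (inj₂ d≗δ) with v ℕ.<? n
... | yes v<n = inj₂ λ y → Σ<-dirac n (λ z → h z y) d≗δ v<n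
... | no  v≮n = inj₁ λ y → Σ<-dirac-beyond n (λ z → h z y) d≗δ (ℕ.≮⇒≥ v≮n)

DiracOrZero : (ℕ → ℚ) → ℕ → Set
DiracOrZero d v = ZeroOrᶠ d (dirac v)

DiracBelow : ℕ → (ℕ → ℚ) → ℕ → Set
DiracBelow n d v = d ≗ dirac v × v ℕ.< n

sumVec-ZeroOrᶠ : ∀ n {ds : Vec (ℕ → ℚ) m} {vs} (F : Vec ℕ m → ℕ → ℚ) →
                 Pointwise DiracOrZero ds vs → ZeroOrᶠ (λ y → sumVec n ds (λ zs → F zs y)) (F vs)
sumVec-ZeroOrᶠ n F []                          = inj₂ λ y → refl
sumVec-ZeroOrᶠ n {_ ∷ ds} {v ∷ vs} F (d∼v ∷ ds∼vs) =
  ZeroOrᶠ-trans (Σ<-ZeroOrᶠ n (λ z y → sumVec n ds (λ zs → F (z ∷ zs) y)) d∼v)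
                (sumVec-ZeroOrᶠ n (λ zs → F (v ∷ zs)) ds∼vs)

sumVec-dirac : ∀ n {ds : Vec (ℕ → ℚ) m} {vs} (F : Vec ℕ m → ℚ) → Pointwise (DiracBelow n) ds vs → sumVec n ds F ≡ F vs
sumVec-dirac n F []                                 = refl
sumVec-dirac n {vs = v ∷ vs} F ((d≗δ , v<n) ∷ ds∼vs) =
  trans (Σ<-dirac n _ d≗δ v<n) (sumVec-dirac n (λ zs → F (v ∷ zs)) ds∼vs)

-- Deterministic terms

-- A stage may be 0 because its truncated sums miss the point carrying the mass.
record Computes (t : PR k) (F : Vec ℕ k → ℕ) : Set where
  field
    zeroOr-dirac     : ∀ n xs → DiracOrZero (⟦ t ⟧ n xs) (F xs)
    eventually-dirac : ∀ xs → Eventually (λ n → ⟦ t ⟧ n xs ≗ dirac (F xs))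
open Computes

Computes-ext : ∀ {t : PR k} {F G} → Computes t F → F ≗ G → Computes t G
zeroOr-dirac     (Computes-ext t⇒F F≗G) n xs = subst (DiracOrZero _) (F≗G xs) (zeroOr-dirac t⇒F n xs)
eventually-dirac (Computes-ext t⇒F F≗G) xs   = subst (λ v → Eventually (λ n → _ ≗ dirac v)) (F≗G xs) (eventually-dirac t⇒F xs)

π : Fin k → PR k
π = proj _

π-computes : (i : Fin k) → Computes (π i) (λ xs → lookup xs i)
zeroOr-dirac     (π-computes i) n xs = inj₂ λ _ → refl
eventually-dirac (π-computes i) xs   = 0 , λ _ _ _ → refl

zeroF-computes : Computes zeroF (const 0)
zeroOr-dirac     zeroF-computes n xs = inj₂ λ _ → refl
eventually-dirac zeroF-computes xs   = 0 , λ _ _ _ → refl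

succF-computes : Computes succF (λ { (x ∷ []) → suc x })
zeroOr-dirac     succF-computes n (x ∷ []) = inj₂ λ _ → refl
eventually-dirac succF-computes (x ∷ [])   = 0 , λ _ _ _ → refl

-- Arity-0 terms only arise from μ; μ z is the constant 0.
zero₀ : PR 0
zero₀ = mu zeroF

zero₀-dirac : ∀ n → ⟦ zero₀ ⟧ n [] ≗ dirac 0
zero₀-dirac n zero    = refl
zero₀-dirac n (suc y) = begin
  1ℚ * (Π< y tails * Σ< n (λ j → δ (suc j) 0))  ≡⟨ cong (λ s → 1ℚ * (Π< y tails * s)) (Σ<-vanishing n λ _ _ → refl) ⟩
  1ℚ * (Π< y tails * 0ℚ)                        ≡⟨ cong (1ℚ *_) (ℚ.*-zeroʳ (Π< y tails)) ⟩
  1ℚ * 0ℚ                                       ≡⟨⟩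
  0ℚ                                            ∎
  where
  open ≡-Reasoning
  tails : ℕ → ℚ
  tails _ = Σ< n (λ j → δ (suc j) 0)

zero₀-computes : Computes zero₀ (const 0)
zeroOr-dirac     zero₀-computes n [] = inj₂ (zero₀-dirac n)
eventually-dirac zero₀-computes []   = 0 , λ n _ → zero₀-dirac n

args-DiracOrZero : ∀ {gs : Vec (PR k) m} {Gs : Vec (Vec ℕ k → ℕ) m} → Pointwise Computes gs Gs → ∀ n xs →
                   Pointwise DiracOrZero (⟦ gs ⟧* n xs) (map (_$ xs) Gs)
args-DiracOrZero []              n xs = []
args-DiracOrZero (g⇒G ∷ gs⇒Gs) n xs = zeroOr-dirac g⇒G n xs ∷ args-DiracOrZero gs⇒Gs n xs

args-eventually : ∀ {gs : Vec (PR k) m} {Gs : Vec (Vec ℕ k → ℕ) m} → Pointwise Computes gs Gs → ∀ xs →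
                  Eventually (λ n → Pointwise (DiracBelow n) (⟦ gs ⟧* n xs) (map (_$ xs) Gs))
args-eventually []                            xs = 0 , λ _ _ → []
args-eventually {Gs = G ∷ _} (g⇒G ∷ gs⇒Gs) xs =
  eventually-map (λ ((d≗δ , v<n) , ds∼vs) → (d≗δ , v<n) ∷ ds∼vs)
    (eventually-× (eventually-× (eventually-dirac g⇒G xs) (eventually-≥ (suc (G xs)))) (args-eventually gs⇒Gs xs))

module _ {gs : Vec (PR k) m} {Gs : Vec (Vec ℕ k → ℕ) m} (gs⇒Gs : Pointwise Computes gs Gs) (f : PR m) where

  comp-ZeroOrᶠ : ∀ n xs → ZeroOrᶠ (⟦ comp f gs ⟧ n xs) (⟦ f ⟧ n (map (_$ xs) Gs))
  comp-ZeroOrᶠ n xs = sumVec-ZeroOrᶠ n (⟦ f ⟧ n) (args-DiracOrZero gs⇒Gs n xs)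

  comp-eventually : ∀ xs → Eventually (λ n → ⟦ comp f gs ⟧ n xs ≗ ⟦ f ⟧ n (map (_$ xs) Gs))
  comp-eventually xs = eventually-map (λ args y → sumVec-dirac _ (λ zs → ⟦ f ⟧ _ zs y) args) (args-eventually gs⇒Gs xs)

comp-computes : ∀ {f : PR m} {F} {gs : Vec (PR k) m} {Gs : Vec (Vec ℕ k → ℕ) m} → Computes f F → Pointwise Computes gs Gs →
                Computes (comp f gs) (λ xs → F (map (_$ xs) Gs))
zeroOr-dirac (comp-computes {f = f} f⇒F gs⇒Gs) n xs =
  ZeroOrᶠ-trans (comp-ZeroOrᶠ gs⇒Gs f n xs) (zeroOr-dirac f⇒F n _)
eventually-dirac (comp-computes {f = f} f⇒F gs⇒Gs) xs =
  eventually-map (λ (e₁ , e₂) y → trans (e₁ y) (e₂ y)) (eventually-× (comp-eventually gs⇒Gs f xs) (eventually-dirac f⇒F _))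

module _ {f : PR k} {g : PR (suc (suc k))} {F G} (f⇒F : Computes f F) (g⇒G : Computes g G)
         (H : Vec ℕ (suc k) → ℕ)
         (H-zero : ∀ xs → H (xs ∷ʳ 0) ≡ F xs)
         (H-suc : ∀ xs y → H (xs ∷ʳ suc y) ≡ G (xs ∷ʳ y ∷ʳ H (xs ∷ʳ y))) where

  private
    stage : ℕ → Vec ℕ k → ℕ → ℕ → ℚ
    stage n = recIter n (⟦ f ⟧ n) (⟦ g ⟧ n)

    stage-DiracOrZero : ∀ n xs y → DiracOrZero (stage n xs y) (H (xs ∷ʳ y))
    stage-DiracOrZero n xs zero    = subst (DiracOrZero _) (sym (H-zero xs)) (zeroOr-dirac f⇒F n xs)
    stage-DiracOrZero n xs (suc y) =
      subst (DiracOrZero _) (sym (H-suc xs y))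
        (ZeroOrᶠ-trans (Σ<-ZeroOrᶠ n (λ z → ⟦ g ⟧ n (xs ∷ʳ y ∷ʳ z)) (stage-DiracOrZero n xs y)) (zeroOr-dirac g⇒G n _))

    stage-eventually : ∀ xs y → Eventually (λ n → stage n xs y ≗ dirac (H (xs ∷ʳ y)))
    stage-eventually xs zero = subst (λ v → Eventually (λ n → _ ≗ dirac v)) (sym (H-zero xs)) (eventually-dirac f⇒F xs)
    stage-eventually xs (suc y) =
      eventually-map (λ { ((stage≗δ , r<n) , g≗δ) w →
                          trans (Σ<-dirac _ (λ z → ⟦ g ⟧ _ (xs ∷ʳ y ∷ʳ z) w) stage≗δ r<n)
                                (trans (g≗δ w) (cong (δ w) (sym (H-suc xs y)))) })
        (eventually-× (eventually-× (stage-eventually xs y) (eventually-≥ (suc (H (xs ∷ʳ y)))))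
                      (eventually-dirac g⇒G (xs ∷ʳ y ∷ʳ H (xs ∷ʳ y))))

    init∷ʳlast : (xs : Vec ℕ (suc k)) → init xs ∷ʳ last xs ≡ xs
    init∷ʳlast xs = sym (proj₂ (proj₂ (initLast xs)))

  rec-computes : Computes (rec f g) H
  zeroOr-dirac rec-computes n xs =
    subst (DiracOrZero _) (cong H (init∷ʳlast xs)) (stage-DiracOrZero n (init xs) (last xs))
  eventually-dirac rec-computes xs =
    subst (λ v → Eventually (λ n → _ ≗ dirac v)) (cong H (init∷ʳlast xs)) (stage-eventually (init xs) (last xs))

-- Primitive recursive arithmetic

predT : PR 1
predT = rec zero₀ (π (# 0))

predT-computes : Computes predT (λ { (y ∷ []) → ℕ.pred y })
predT-computes = rec-computes zero₀-computes (π-computes (# 0)) _ (λ { [] → refl }) (λ { [] y → refl })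

monusT : PR 2
monusT = rec (π (# 0)) (comp predT (π (# 2) ∷ []))

monusT-computes : Computes monusT (λ { (x ∷ y ∷ []) → x ℕ.∸ y })
monusT-computes = rec-computes (π-computes (# 0)) (comp-computes predT-computes (π-computes (# 2) ∷ [])) _
  (λ { (x ∷ []) → refl }) (λ { (x ∷ []) y → sym (ℕ.pred[m∸n]≡m∸[1+n] x y) })

plusT : PR 2
plusT = rec (π (# 0)) (comp succF (π (# 2) ∷ []))

plusT-computes : Computes plusT (λ { (x ∷ y ∷ []) → x ℕ.+ y })
plusT-computes = rec-computes (π-computes (# 0)) (comp-computes succF-computes (π-computes (# 2) ∷ [])) _
  (λ { (x ∷ []) → ℕ.+-identityʳ x }) (λ { (x ∷ []) y → ℕ.+-suc x y })

doubleT : PR 1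
doubleT = comp plusT (π (# 0) ∷ π (# 0) ∷ [])

doubleT-computes : Computes doubleT (λ { (x ∷ []) → x ℕ.+ x })
doubleT-computes = Computes-ext (comp-computes plusT-computes (π-computes (# 0) ∷ π-computes (# 0) ∷ []))
  λ { (x ∷ []) → refl }

ifZero : ℕ → ℕ → ℕ → ℕ
ifZero p q zero    = p
ifZero p q (suc _) = q

ifZeroT : PR 3
ifZeroT = rec (π (# 0)) (π (# 1))

ifZeroT-computes : Computes ifZeroT (λ { (p ∷ q ∷ v ∷ []) → ifZero p q v })
ifZeroT-computes = rec-computes (π-computes (# 0)) (π-computes (# 1)) _
  (λ { (p ∷ q ∷ []) → refl }) (λ { (p ∷ q ∷ []) y → refl })

-- Decoding the Cantor pairing

tri : ℕ → ℕ
tri zero    = 0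
tri (suc s) = suc (tri s ℕ.+ s)

triT : PR 1
triT = rec zero₀ (comp succF (comp plusT (π (# 1) ∷ π (# 0) ∷ []) ∷ []))

triT-computes : Computes triT (λ { (s ∷ []) → tri s })
triT-computes = rec-computes zero₀-computes
  (comp-computes succF-computes (comp-computes plusT-computes (π-computes (# 1) ∷ π-computes (# 0) ∷ []) ∷ [])) _
  (λ { [] → refl }) (λ { [] s → refl })

tri-double : ∀ s → tri s ℕ.* 2 ≡ s ℕ.* suc s
tri-double zero    = refl
tri-double (suc s) = begin
  suc (tri s ℕ.+ s) ℕ.* 2
    ≡⟨ solve 2 (λ t s → (con 1 :+ (t :+ s)) :* con 2 := t :* con 2 :+ (con 2 :+ s :* con 2)) refl (tri s) s ⟩
  tri s ℕ.* 2 ℕ.+ (2 ℕ.+ s ℕ.* 2)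
    ≡⟨ cong (ℕ._+ (2 ℕ.+ s ℕ.* 2)) (tri-double s) ⟩
  s ℕ.* suc s ℕ.+ (2 ℕ.+ s ℕ.* 2)
    ≡⟨ solve 1 (λ s → s :* (con 1 :+ s) :+ (con 2 :+ s :* con 2) := (con 1 :+ s) :* (con 2 :+ s)) refl s ⟩
  suc s ℕ.* suc (suc s)
    ∎
  where
  open ≡-Reasoning
  open ℕ-Solver.+-*-Solver

pair≡tri+ : ∀ a b → pair a b ≡ tri (a ℕ.+ b) ℕ.+ b
pair≡tri+ a b = cong (ℕ._+ b) (trans (cong (ℕ._/ 2) (sym (tri-double (a ℕ.+ b)))) (ℕ.m*n/n≡m (tri (a ℕ.+ b)) 2))

tri-mono : ∀ {s s'} → s ℕ.≤ s' → tri s ℕ.≤ tri s'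
tri-mono {s' = zero}   z≤n   = ℕ.≤-refl
tri-mono {s' = suc s'} s≤1+s' with ℕ.m≤n⇒m<n∨m≡n s≤1+s'
... | inj₁ s<1+s' = ℕ.m≤n⇒m≤1+n (ℕ.≤-trans (tri-mono (ℕ.≤-pred s<1+s')) (ℕ.m≤m+n (tri s') s'))
... | inj₂ refl   = ℕ.≤-refl

OnDiagonal : ℕ → ℕ → Set
OnDiagonal s c = tri s ℕ.≤ c × c ℕ.≤ tri s ℕ.+ s

diag : ℕ → ℕ
diag zero    = 0
diag (suc c) = ifZero (suc (diag c)) (diag c) (tri (suc (diag c)) ℕ.∸ suc c)

diagT : PR 1
diagT = rec zero₀ (comp ifZeroT (comp succF (π (# 1) ∷ []) ∷ π (# 1) ∷
                                 comp monusT (comp triT (comp succF (π (# 1) ∷ []) ∷ []) ∷ comp succF (π (# 0) ∷ []) ∷ []) ∷ []))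

diagT-computes : Computes diagT (λ { (c ∷ []) → diag c })
diagT-computes = rec-computes zero₀-computes
  (comp-computes ifZeroT-computes
    (comp-computes succF-computes (π-computes (# 1) ∷ []) ∷ π-computes (# 1) ∷
     comp-computes monusT-computes (comp-computes triT-computes (comp-computes succF-computes (π-computes (# 1) ∷ []) ∷ []) ∷
                                    comp-computes succF-computes (π-computes (# 0) ∷ []) ∷ []) ∷ [])) _
  (λ { [] → refl }) (λ { [] c → refl })

diag-onDiagonal : ∀ c → OnDiagonal (diag c) c
diag-onDiagonal zero    = z≤n , z≤n
diag-onDiagonal (suc c) with diag-onDiagonal c | tri (suc (diag c)) ℕ.∸ suc c in next∸1+c
... | lo , hi | zero  = ℕ.m∸n≡0⇒m≤n next∸1+c , s≤s (ℕ.≤-trans hi (ℕ.m≤m+n _ (suc (diag c))))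
... | lo , hi | suc _ = ℕ.m≤n⇒m≤1+n lo , ℕ.≤-pred (ℕ.m∸n≢0⇒n<m (ℕ.1+n≢0 ∘ trans (sym next∸1+c)))

onDiagonal-≮ : ∀ {s s' c} → OnDiagonal s c → OnDiagonal s' c → s ℕ.≮ s'
onDiagonal-≮ {c = c} (_ , hi) (lo' , _) s<s' = ℕ.n≮n c (ℕ.<-≤-trans (s≤s hi) (ℕ.≤-trans (tri-mono s<s') lo'))

onDiagonal-unique : ∀ {s s' c} → OnDiagonal s c → OnDiagonal s' c → s ≡ s'
onDiagonal-unique on on' = ℕ.≤-antisym (ℕ.≮⇒≥ (onDiagonal-≮ on' on)) (ℕ.≮⇒≥ (onDiagonal-≮ on on'))

diag-pair : ∀ a b → diag (pair a b) ≡ a ℕ.+ b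
diag-pair a b = onDiagonal-unique (diag-onDiagonal (pair a b))
  (subst (OnDiagonal (a ℕ.+ b)) (sym (pair≡tri+ a b)) (ℕ.m≤m+n _ b , ℕ.+-monoʳ-≤ (tri (a ℕ.+ b)) (ℕ.m≤n+m b a)))

unpair₂ : ℕ → ℕ
unpair₂ c = c ℕ.∸ tri (diag c)

unpair₁ : ℕ → ℕ
unpair₁ c = diag c ℕ.∸ unpair₂ c

unpair₂-pair : ∀ a b → unpair₂ (pair a b) ≡ b
unpair₂-pair a b = begin
  pair a b ℕ.∸ tri (diag (pair a b))       ≡⟨ cong (λ s → pair a b ℕ.∸ tri s) (diag-pair a b) ⟩
  pair a b ℕ.∸ tri (a ℕ.+ b)               ≡⟨ cong (ℕ._∸ tri (a ℕ.+ b)) (pair≡tri+ a b) ⟩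
  tri (a ℕ.+ b) ℕ.+ b ℕ.∸ tri (a ℕ.+ b)    ≡⟨ ℕ.m+n∸m≡n (tri (a ℕ.+ b)) b ⟩
  b                                        ∎
  where open ≡-Reasoning

unpair₁-pair : ∀ a b → unpair₁ (pair a b) ≡ a
unpair₁-pair a b = trans (cong₂ ℕ._∸_ (diag-pair a b) (unpair₂-pair a b)) (ℕ.m+n∸n≡m a b)

unpair₂T : PR 1
unpair₂T = comp monusT (π (# 0) ∷ comp triT (diagT ∷ []) ∷ [])

unpair₂T-computes : Computes unpair₂T (λ { (c ∷ []) → unpair₂ c })
unpair₂T-computes = Computes-ext
  (comp-computes monusT-computes (π-computes (# 0) ∷ comp-computes triT-computes (diagT-computes ∷ []) ∷ []))
  λ { (c ∷ []) → refl }

unpair₁T : PR 1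
unpair₁T = comp monusT (diagT ∷ unpair₂T ∷ [])

unpair₁T-computes : Computes unpair₁T (λ { (c ∷ []) → unpair₁ c })
unpair₁T-computes = Computes-ext (comp-computes monusT-computes (diagT-computes ∷ unpair₂T-computes ∷ []))
  λ { (c ∷ []) → refl }

-- Binary long division: the i-th binary digit of a / B is bit B (remainder a B i).

step : ℕ → ℕ → ℕ
step B r = ifZero (r ℕ.+ r ℕ.∸ B) (r ℕ.+ r) (B ℕ.∸ (r ℕ.+ r))

bit : ℕ → ℕ → ℕ
bit B r = ifZero 1 0 (B ℕ.∸ (r ℕ.+ r))

remainder : ℕ → ℕ → ℕ → ℕ
remainder a B zero    = a
remainder a B (suc i) = step B (remainder a B i)

step-cases : ∀ B r → B ℕ.≤ r ℕ.+ r × step B r ≡ r ℕ.+ r ℕ.∸ B × bit B r ≡ 1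
                   ⊎ r ℕ.+ r ℕ.< B × step B r ≡ r ℕ.+ r × bit B r ≡ 0
step-cases B r with B ℕ.∸ (r ℕ.+ r) in B∸2r
... | zero  = inj₁ (ℕ.m∸n≡0⇒m≤n B∸2r , refl , refl)
... | suc _ = inj₂ (ℕ.m∸n≢0⇒n<m (ℕ.1+n≢0 ∘ trans (sym B∸2r)) , refl , refl)

bit-01 : ∀ B r → bit B r ≡ 0 ⊎ bit B r ≡ 1
bit-01 B r with step-cases B r
... | inj₁ (_ , _ , bit≡1) = inj₂ bit≡1
... | inj₂ (_ , _ , bit≡0) = inj₁ bit≡0

step-≤ : ∀ {B r} → r ℕ.≤ B → step B r ℕ.≤ B
step-≤ {B} {r} r≤B with step-cases B r
... | inj₁ (_ , step≡ , _) rewrite step≡ =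
  subst (r ℕ.+ r ℕ.∸ B ℕ.≤_) (ℕ.m+n∸n≡m B B) (ℕ.∸-monoˡ-≤ B (ℕ.+-mono-≤ r≤B r≤B))
... | inj₂ (2r<B , step≡ , _) rewrite step≡ = ℕ.<⇒≤ 2r<B

double₂T : PR 2
double₂T = comp doubleT (π (# 1) ∷ [])

double₂T-computes : Computes double₂T (λ { (B ∷ r ∷ []) → r ℕ.+ r })
double₂T-computes = Computes-ext (comp-computes doubleT-computes (π-computes (# 1) ∷ [])) λ { (B ∷ r ∷ []) → refl }

stepT : PR 2
stepT = comp ifZeroT (comp monusT (double₂T ∷ π (# 0) ∷ []) ∷ double₂T ∷ comp monusT (π (# 0) ∷ double₂T ∷ []) ∷ [])

stepT-computes : Computes stepT (λ { (B ∷ r ∷ []) → step B r })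
stepT-computes = Computes-ext
  (comp-computes ifZeroT-computes
    (comp-computes monusT-computes (double₂T-computes ∷ π-computes (# 0) ∷ []) ∷ double₂T-computes ∷
     comp-computes monusT-computes (π-computes (# 0) ∷ double₂T-computes ∷ []) ∷ []))
  λ { (B ∷ r ∷ []) → refl }

bitT : PR 2
bitT = comp ifZeroT (comp succF (comp zeroF (π (# 0) ∷ []) ∷ []) ∷ comp zeroF (π (# 0) ∷ []) ∷
                     comp monusT (π (# 0) ∷ double₂T ∷ []) ∷ [])

bitT-computes : Computes bitT (λ { (B ∷ r ∷ []) → bit B r })
bitT-computes = Computes-ext
  (comp-computes ifZeroT-computes
    (comp-computes succF-computes (comp-computes zeroF-computes (π-computes (# 0) ∷ []) ∷ []) ∷
     comp-computes zeroF-computes (π-computes (# 0) ∷ []) ∷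
     comp-computes monusT-computes (π-computes (# 0) ∷ double₂T-computes ∷ []) ∷ []))
  λ { (B ∷ r ∷ []) → refl }

remainderT : PR 2
remainderT = rec unpair₁T (comp stepT (comp unpair₂T (π (# 0) ∷ []) ∷ π (# 2) ∷ []))

remainderT-computes : Computes remainderT (λ { (c ∷ i ∷ []) → remainder (unpair₁ c) (unpair₂ c) i })
remainderT-computes = rec-computes unpair₁T-computes
  (comp-computes stepT-computes (comp-computes unpair₂T-computes (π-computes (# 0) ∷ []) ∷ π-computes (# 2) ∷ [])) _
  (λ { (c ∷ []) → refl }) (λ { (c ∷ []) i → refl })

digitT : PR 2
digitT = comp bitT (comp unpair₂T (π (# 0) ∷ []) ∷ remainderT ∷ [])

digitT-computes : Computes digitT (λ { (c ∷ i ∷ []) → bit (unpair₂ c) (remainder (unpair₁ c) (unpair₂ c) i) })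
digitT-computes = Computes-ext
  (comp-computes bitT-computes (comp-computes unpair₂T-computes (π-computes (# 0) ∷ []) ∷ remainderT-computes ∷ []))
  λ { (c ∷ i ∷ []) → refl }

-- Rational arithmetic

ι : ℕ → ℚ
ι n = + n ℚ./ 1

ι-nonneg : ∀ n → 0ℚ ≤ ι n
ι-nonneg n = ℚ.nonNegative⁻¹ (ι n) {{ℚ.normalize-nonNeg n 1}}

ι-ᵘ : ∀ n → toℚᵘ (ι n) ℚᵘ.≃ mkℚᵘ (+ n) 0
ι-ᵘ n = ℚ.toℚᵘ-fromℚᵘ (mkℚᵘ (+ n) 0)

ι-+ : ∀ m n → ι (m ℕ.+ n) ≡ ι m + ι n
ι-+ m n = ℚ.toℚᵘ-injective (begin
  toℚᵘ (ι (m ℕ.+ n))              ≈⟨ ι-ᵘ (m ℕ.+ n) ⟩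
  mkℚᵘ (+ (m ℕ.+ n)) 0            ≈⟨ *≡* (cong (ℤ._* + 1) (trans (ℤ.pos-+ m n)
                                          (cong₂ ℤ._+_ (sym (ℤ.*-identityʳ (+ m))) (sym (ℤ.*-identityʳ (+ n)))))) ⟩
  mkℚᵘ (+ m) 0 ℚᵘ.+ mkℚᵘ (+ n) 0  ≈⟨ ℚᵘ.+-cong (ι-ᵘ m) (ι-ᵘ n) ⟨
  toℚᵘ (ι m) ℚᵘ.+ toℚᵘ (ι n)      ≈⟨ ℚ.toℚᵘ-homo-+ (ι m) (ι n) ⟨
  toℚᵘ (ι m + ι n)                ∎)
  where open ℚᵘ.≃-Reasoning

ι-mono : ∀ {m n} → m ℕ.≤ n → ι m ≤ ι n
ι-mono {m} {n} m≤n = begin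
  ι m                   ≡⟨ ℚ.+-identityʳ (ι m) ⟨
  ι m + 0ℚ              ≤⟨ ℚ.+-monoʳ-≤ (ι m) (ι-nonneg (n ℕ.∸ m)) ⟩
  ι m + ι (n ℕ.∸ m)     ≡⟨ ι-+ m (n ℕ.∸ m) ⟨
  ι (m ℕ.+ (n ℕ.∸ m))   ≡⟨ cong ι (ℕ.m+[n∸m]≡n m≤n) ⟩
  ι n                   ∎
  where open ℚ.≤-Reasoning

*-denominator : ∀ x d q → toℚᵘ q ℚᵘ.≃ mkℚᵘ (+ x) d → q * ι (suc d) ≡ ι x
*-denominator x d q q≃x/d = ℚ.toℚᵘ-injective (begin
  toℚᵘ (q * ι (suc d))                ≈⟨ ℚ.toℚᵘ-homo-* q (ι (suc d)) ⟩
  toℚᵘ q ℚᵘ.* toℚᵘ (ι (suc d))        ≈⟨ ℚᵘ.*-cong q≃x/d (ι-ᵘ (suc d)) ⟩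
  mkℚᵘ (+ x) d ℚᵘ.* mkℚᵘ (+ suc d) 0  ≈⟨ *≡* (trans (ℤ.*-identityʳ _) (cong (λ e → + x ℤ.* + suc e) (sym (ℕ.*-identityʳ d)))) ⟩
  mkℚᵘ (+ x) 0                        ≈⟨ ι-ᵘ x ⟨
  toℚᵘ (ι x)                          ∎)
  where open ℚᵘ.≃-Reasoning

nonneg-* : ∀ {x y} → 0ℚ ≤ x → 0ℚ ≤ y → 0ℚ ≤ x * y
nonneg-* {x} {y} 0≤x 0≤y = ℚ.nonNegative⁻¹ (x * y) {{ℚ.nonNeg*nonNeg⇒nonNeg x {{nonNegative 0≤x}} y {{nonNegative 0≤y}}}}

0≤½ : 0ℚ ≤ ½
0≤½ = ℚ.*≤* (ℤ.+≤+ z≤n)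

½≤1 : ½ ≤ 1ℚ
½≤1 = ℚ.*≤* (ℤ.+≤+ (s≤s z≤n))

½^ : ℕ → ℚ
½^ i = Π< i (const ½)

½^-nonneg : ∀ M → 0ℚ ≤ ½^ M
½^-nonneg zero    = 0≤1
½^-nonneg (suc M) = nonneg-* (½^-nonneg M) 0≤½

½^≤1 : ∀ M → ½^ M ≤ 1ℚ
½^≤1 zero    = ℚ.≤-refl
½^≤1 (suc M) = ℚ.≤-trans (ℚ.*-monoʳ-≤-nonNeg ½ {{nonNegative 0≤½}} (½^≤1 M)) ½≤1

½^-*-suc≤1 : ∀ M → ½^ M * ι (suc M) ≤ 1ℚ
½^-*-suc≤1 zero    = ℚ.≤-refl
½^-*-suc≤1 (suc M) = begin
  ½^ M * ½ * ι (2 ℕ.+ M)                  ≡⟨ cong (½^ M * ½ *_) (ι-+ 1 (suc M)) ⟩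
  ½^ M * ½ * (1ℚ + ι (suc M))             ≡⟨ solve 2 (λ h i → h :* con ½ :* (con 1ℚ :+ i) := con ½ :* h :+ con ½ :* (h :* i))
                                                     refl (½^ M) (ι (suc M)) ⟩
  ½ * ½^ M + ½ * (½^ M * ι (suc M))       ≤⟨ ℚ.+-mono-≤ (ℚ.*-monoˡ-≤-nonNeg ½ {{nonNegative 0≤½}} (½^≤1 M))
                                                        (ℚ.*-monoˡ-≤-nonNeg ½ {{nonNegative 0≤½}} (½^-*-suc≤1 M)) ⟩
  ½ * 1ℚ + ½ * 1ℚ                         ≡⟨⟩
  1ℚ                                      ∎
  where
  open ℚ.≤-Reasoning
  open +-*-Solver

-- ε = (k+1)/(d+1) satisfies ε (d+2) > ε (d+1) ≥ 1 ≥ 2^-(d+1) (d+2).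
½^-small : ∀ ε → 0ℚ < ε → ∃ λ M → ½^ M < ε
½^-small (mkℚ +0 d _)       (ℚ.*<* 0<0) = ⊥-elim (ℤ.<-irrefl refl 0<0)
½^-small (mkℚ -[1+ k ] d _) (ℚ.*<* ())
½^-small ε@(mkℚ +[1+ k ] d _) 0<ε = suc d , ℚ.*-cancelʳ-<-nonNeg (ι (2 ℕ.+ d)) {{nonNegative (ι-nonneg (2 ℕ.+ d))}} (begin-strict
  ½^ (suc d) * ι (2 ℕ.+ d)  ≤⟨ ½^-*-suc≤1 (suc d) ⟩
  1ℚ                        ≡⟨ ℚ.+-identityˡ 1ℚ ⟨
  0ℚ + 1ℚ                   <⟨ ℚ.+-mono-<-≤ 0<ε (ℚ.≤-trans (ι-mono {1} {suc k} (s≤s z≤n))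
                                                            (ℚ.≤-reflexive (sym (*-denominator (suc k) d ε ℚᵘ.≃-refl)))) ⟩
  ε + ε * ι (suc d)         ≡⟨ solve 2 (λ e i → e :+ e :* i := e :* (con 1ℚ :+ i)) refl ε (ι (suc d)) ⟩
  ε * (1ℚ + ι (suc d))      ≡⟨ cong (ε *_) (ι-+ 1 (suc d)) ⟨
  ε * ι (2 ℕ.+ d)           ∎)
  where
  open ℚ.≤-Reasoning
  open +-*-Solver

-- Unlike SupIs, the lower bound holds at all late stages, so it survives eventual equality.
Approaches : (ℕ → ℚ) → ℚ → Set
Approaches f q = (∀ n → f n ≤ q) × (∀ ε → 0ℚ < ε → Eventually (λ n → q - ε < f n))

Approaches⇒SupIs : ∀ {f q} → Approaches f q → SupIs f q
Approaches⇒SupIs (upper , lower) = upper , λ ε 0<ε → let (N , from-N) = lower ε 0<ε in N , from-N N ℕ.≤-refl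

q-ε<q : ∀ q {ε} → 0ℚ < ε → q - ε < q
q-ε<q q {ε} 0<ε = begin-strict
  q - ε   <⟨ ℚ.+-monoʳ-< q (ℚ.neg-antimono-< 0<ε) ⟩
  q - 0ℚ  ≡⟨ ℚ.+-identityʳ q ⟩
  q       ∎
  where open ℚ.≤-Reasoning

Approaches-0 : ∀ {f} → (∀ n → f n ≡ 0ℚ) → Approaches f 0ℚ
Approaches-0 f≡0 = (λ n → ℚ.≤-reflexive (f≡0 n)) , λ ε 0<ε → 0 , λ n _ → subst (0ℚ - ε <_) (sym (f≡0 n)) (q-ε<q 0ℚ 0<ε)

Approaches-ZeroOr : ∀ {f g q} → Approaches f q → 0ℚ ≤ q → (∀ n → ZeroOr (g n) (f n)) → Eventually (λ n → g n ≡ f n) →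
                    Approaches g q
Approaches-ZeroOr {f} {g} {q} (upper , lower) 0≤q g∼f g≡f = upper′ , lower′
  where
  upper′ : ∀ n → g n ≤ q
  upper′ n with g∼f n
  ... | inj₁ g≡0 = subst (_≤ q) (sym g≡0) 0≤q
  ... | inj₂ g≡f = subst (_≤ q) (sym g≡f) (upper n)
  lower′ : ∀ ε → 0ℚ < ε → Eventually (λ n → q - ε < g n)
  lower′ ε 0<ε = eventually-map (λ (q-ε<f , g≡f) → subst (q - ε <_) (sym g≡f) q-ε<f) (eventually-× (lower ε 0<ε) g≡f)

SupIs-½^ : ∀ {s e : ℕ → ℚ} {q} → (∀ M → 0ℚ ≤ e M) → (∀ M → e M ≤ 1ℚ) → (∀ M → s M + ½^ M * e M ≡ q) →
           SupIs s q
SupIs-½^ {s} {e} {q} 0≤e e≤1 s+e≡q = upper , lower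
  where
  upper : ∀ M → s M ≤ q
  upper M = begin
    s M                   ≡⟨ ℚ.+-identityʳ (s M) ⟨
    s M + 0ℚ              ≤⟨ ℚ.+-monoʳ-≤ (s M) (nonneg-* (½^-nonneg M) (0≤e M)) ⟩
    s M + ½^ M * e M      ≡⟨ s+e≡q M ⟩
    q                     ∎
    where open ℚ.≤-Reasoning
  ½^-*e≤½^ : ∀ M → ½^ M * e M ≤ ½^ M
  ½^-*e≤½^ M = ℚ.≤-trans (ℚ.*-monoˡ-≤-nonNeg (½^ M) {{nonNegative (½^-nonneg M)}} (e≤1 M)) (ℚ.≤-reflexive (ℚ.*-identityʳ (½^ M)))
  lower : ∀ ε → 0ℚ < ε → ∃ λ M → q - ε < s M
  lower ε 0<ε = let (M , ½^M<ε) = ½^-small ε 0<ε in M , (begin-strict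
    q - ε                      <⟨ ℚ.+-monoʳ-< q (ℚ.neg-antimono-< ½^M<ε) ⟩
    q - ½^ M                   ≤⟨ ℚ.+-monoʳ-≤ q (ℚ.neg-antimono-≤ (½^-*e≤½^ M)) ⟩
    q - ½^ M * e M             ≡⟨ cong (_- ½^ M * e M) (s+e≡q M) ⟨
    s M + ½^ M * e M - ½^ M * e M  ≡⟨ solve 2 (λ s x → s :+ x :- x := s) refl (s M) (½^ M * e M) ⟩
    s M                        ∎)
    where
    open ℚ.≤-Reasoning
    open +-*-Solver

Σ<-approaches : ∀ {a : ℕ → ℕ → ℚ} {t : ℕ → ℚ} {q} → (∀ i → 0ℚ ≤ t i) → (∀ n i → ZeroOr (a n i) (t i)) →
                (∀ M → Eventually (λ n → ∀ i → i ℕ.< M → a n i ≡ t i)) → SupIs (λ M → Σ< M t) q →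
                Approaches (λ n → Σ< n (a n)) q
Σ<-approaches {a} {t} {q} 0≤t a∼t a≡t (upper , lower) = upper′ , lower′
  where
  upper′ : ∀ n → Σ< n (a n) ≤ q
  upper′ n = ℚ.≤-trans (Σ<-mono-≤ n (λ i → proj₂ (ZeroOr-bounds (0≤t i) (a∼t n i)))) (upper n)
  lower′ : ∀ ε → 0ℚ < ε → Eventually (λ n → q - ε < Σ< n (a n))
  lower′ ε 0<ε = let (M , q-ε<ΣM) = lower ε 0<ε in
    eventually-map (λ { {n} (a≡t , M≤n) → begin-strict
                        q - ε         <⟨ q-ε<ΣM ⟩
                        Σ< M t        ≡⟨ Σ<-cong M (λ i i<M → a≡t i i<M) ⟨
                        Σ< M (a n)    ≤⟨ Σ<-mono-length (λ i → proj₁ (ZeroOr-bounds (0≤t i) (a∼t n i))) M≤n ⟩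
                        Σ< n (a n)    ∎ })
      (eventually-× (a≡t M) (eventually-≥ M))
    where open ℚ.≤-Reasoning

-- Binary expansion

bernoulli : ℚ → ℕ → ℚ
bernoulli x 0             = 1ℚ - x
bernoulli x 1             = x
bernoulli x (suc (suc _)) = 0ℚ

bernoulli-affine : ∀ x z y → bernoulli ((x + x) - z) y ≡ (bernoulli x y + bernoulli x y) - bernoulli z y
bernoulli-affine x z 0             =
  solve 2 (λ x z → con 1ℚ :- ((x :+ x) :- z) := ((con 1ℚ :- x) :+ (con 1ℚ :- x)) :- (con 1ℚ :- z)) refl x z
  where open +-*-Solver
bernoulli-affine x z 1             = refl
bernoulli-affine x z (suc (suc _)) = refl

δ-bernoulli : ∀ y {b} → b ≡ 0 ⊎ b ≡ 1 → δ y b ≡ bernoulli (ι b) y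
δ-bernoulli 0             (inj₁ refl) = refl
δ-bernoulli 0             (inj₂ refl) = refl
δ-bernoulli 1             (inj₁ refl) = refl
δ-bernoulli 1             (inj₂ refl) = refl
δ-bernoulli (suc (suc _)) (inj₁ refl) = refl
δ-bernoulli (suc (suc _)) (inj₂ refl) = refl

bernoulli-bounds : ∀ {x} → 0ℚ ≤ x → x ≤ 1ℚ → ∀ y → 0ℚ ≤ bernoulli x y × bernoulli x y ≤ 1ℚ
bernoulli-bounds {x} 0≤x x≤1 0 =
  ℚ.≤-trans (ℚ.≤-reflexive (sym (ℚ.+-inverseʳ x))) (ℚ.+-monoˡ-≤ (- x) x≤1) ,
  ℚ.+-monoʳ-≤ 1ℚ (ℚ.neg-antimono-≤ 0≤x)
bernoulli-bounds 0≤x x≤1 1             = 0≤x , x≤1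
bernoulli-bounds 0≤x x≤1 (suc (suc _)) = ℚ.≤-refl , 0≤1

I2P-valid : ∀ {a b} → a ℕ.≤ suc b → ∀ y → I2P a (suc b) y ≡ bernoulli (+ a ℚ./ suc b) y
I2P-valid {a} {b} a≤1+b y with a ≤ᵇ suc b | ℕ.≤ᵇ-reflects-≤ a (suc b)
... | false | ofⁿ a≰1+b = ⊥-elim (a≰1+b a≤1+b)
... | true  | _ with y
...   | 0           = refl
...   | 1           = refl
...   | suc (suc _) = refl

I2P-invalid : ∀ {a b} → a ℕ.≰ suc b → ∀ y → I2P a (suc b) y ≡ 0ℚ
I2P-invalid {a} {b} a≰1+b y with a ≤ᵇ suc b | ℕ.≤ᵇ-reflects-≤ a (suc b)
... | false | _         = refl
... | true  | ofʸ a≤1+b = ⊥-elim (a≰1+b a≤1+b)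

ι-step : ∀ B r → ι (step B r) + ι (bit B r) * ι B ≡ ι r + ι r
ι-step B r with step-cases B r
... | inj₁ (B≤2r , step≡ , bit≡) rewrite step≡ | bit≡ = begin
  ι (r ℕ.+ r ℕ.∸ B) + 1ℚ * ι B   ≡⟨ cong (_+_ (ι (r ℕ.+ r ℕ.∸ B))) (ℚ.*-identityˡ (ι B)) ⟩
  ι (r ℕ.+ r ℕ.∸ B) + ι B        ≡⟨ ι-+ (r ℕ.+ r ℕ.∸ B) B ⟨
  ι (r ℕ.+ r ℕ.∸ B ℕ.+ B)        ≡⟨ cong ι (ℕ.m∸n+n≡m B≤2r) ⟩
  ι (r ℕ.+ r)                    ≡⟨ ι-+ r r ⟩
  ι r + ι r                      ∎
  where open ≡-Reasoning
... | inj₂ (_ , step≡ , bit≡) rewrite step≡ | bit≡ = begin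
  ι (r ℕ.+ r) + 0ℚ * ι B  ≡⟨ cong (_+_ (ι (r ℕ.+ r))) (ℚ.*-zeroˡ (ι B)) ⟩
  ι (r ℕ.+ r) + 0ℚ        ≡⟨ ℚ.+-identityʳ (ι (r ℕ.+ r)) ⟩
  ι (r ℕ.+ r)             ≡⟨ ι-+ r r ⟩
  ι r + ι r               ∎
  where open ≡-Reasoning

module BinaryExpansion (a b : ℕ) (a≤1+b : a ℕ.≤ suc b) where

  p : ℚ
  p = + a ℚ./ suc b

  B : ℚ
  B = ι (suc b)

  instance
    B-positive : ℚ.Positive B
    B-positive = ℚ.normalize-pos (suc b) 1

  r : ℕ → ℕ
  r = remainder a (suc b)

  digit : ℕ → ℕ
  digit i = bit (suc b) (r i)

  -- ρ i = r i / B, the part of a / B not yet accounted for by the first i digits, scaled by 2^i.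
  ρ : ℕ → ℚ
  ρ zero    = p
  ρ (suc i) = (ρ i + ρ i) - ι (digit i)

  ρ*B : ∀ i → ρ i * B ≡ ι (r i)
  ρ*B zero    = *-denominator a b p (ℚ.toℚᵘ-fromℚᵘ (mkℚᵘ (+ a) b))
  ρ*B (suc i) = begin
    ((ρ i + ρ i) - ι (digit i)) * B
      ≡⟨ solve 3 (λ ρ d x → ((ρ :+ ρ) :- d) :* x := (ρ :* x :+ ρ :* x) :- d :* x) refl (ρ i) (ι (digit i)) B ⟩
    (ρ i * B + ρ i * B) - ι (digit i) * B
      ≡⟨ cong (λ u → (u + u) - ι (digit i) * B) (ρ*B i) ⟩
    (ι (r i) + ι (r i)) - ι (digit i) * B
      ≡⟨ cong (_- ι (digit i) * B) (ι-step (suc b) (r i)) ⟨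
    (ι (r (suc i)) + ι (digit i) * B) - ι (digit i) * B
      ≡⟨ solve 2 (λ u v → (u :+ v) :- v := u) refl (ι (r (suc i))) (ι (digit i) * B) ⟩
    ι (r (suc i))
      ∎
    where
    open ≡-Reasoning
    open +-*-Solver

  r≤B : ∀ i → r i ℕ.≤ suc b
  r≤B zero    = a≤1+b
  r≤B (suc i) = step-≤ (r≤B i)

  ρ-nonneg : ∀ i → 0ℚ ≤ ρ i
  ρ-nonneg i = ℚ.*-cancelʳ-≤-pos B (subst₂ _≤_ (sym (ℚ.*-zeroˡ B)) (sym (ρ*B i)) (ι-nonneg (r i)))

  ρ≤1 : ∀ i → ρ i ≤ 1ℚ
  ρ≤1 i = ℚ.*-cancelʳ-≤-pos B (subst₂ _≤_ (sym (ρ*B i)) (sym (ℚ.*-identityˡ B)) (ι-mono (r≤B i)))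

  term : ℕ → ℕ → ℚ
  term y i = ½ * ½^ i * δ y (digit i)

  term-nonneg : ∀ y i → 0ℚ ≤ term y i
  term-nonneg y i = nonneg-* (nonneg-* 0≤½ (½^-nonneg i)) (δ-nonneg y (digit i))

  -- Preserved by a digit step since bernoulli x y is affine in x and equals δ y on digits.
  Σ<-term : ∀ y M → Σ< M (term y) + ½^ M * bernoulli (ρ M) y ≡ bernoulli p y
  Σ<-term y zero    = trans (ℚ.+-identityˡ _) (ℚ.*-identityˡ _)
  Σ<-term y (suc M) = begin
    (Σ< M (term y) + ½ * ½^ M * δ y (digit M)) + ½^ M * ½ * bernoulli ((ρ M + ρ M) - ι (digit M)) y
      ≡⟨ cong₂ (λ u v → (Σ< M (term y) + ½ * ½^ M * u) + ½^ M * ½ * v)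
               (δ-bernoulli y (bit-01 (suc b) (r M))) (bernoulli-affine (ρ M) (ι (digit M)) y) ⟩
    (Σ< M (term y) + ½ * ½^ M * βd) + ½^ M * ½ * ((βρ + βρ) - βd)
      ≡⟨ solve 4 (λ s h x d → (s :+ con ½ :* h :* d) :+ h :* con ½ :* ((x :+ x) :- d) := s :+ h :* x)
                 refl (Σ< M (term y)) (½^ M) βρ βd ⟩
    Σ< M (term y) + ½^ M * βρ
      ≡⟨ Σ<-term y M ⟩
    bernoulli p y ∎
    where
    open ≡-Reasoning
    open +-*-Solver
    βρ βd : ℚ
    βρ = bernoulli (ρ M) y
    βd = bernoulli (ι (digit M)) y

  series-SupIs : ∀ y → SupIs (λ M → Σ< M (term y)) (bernoulli p y)
  series-SupIs y = SupIs-½^ (λ M → proj₁ (β-bounds M)) (λ M → proj₂ (β-bounds M)) (Σ<-term y)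
    where
    β-bounds : ∀ M → 0ℚ ≤ bernoulli (ρ M) y × bernoulli (ρ M) y ≤ 1ℚ
    β-bounds M = bernoulli-bounds (ρ-nonneg M) (ρ≤1 M) y

coinDist : ℕ → ℕ → ℚ
coinDist e = ⟦ coin ⟧ 0 (e ∷ [])

coinDist-≢0 : ∀ {e} → e ≢ 0 → coinDist e 0 ≡ 0ℚ
coinDist-≢0 {zero}  e≢0 = ⊥-elim (e≢0 refl)
coinDist-≢0 {suc e} _   = refl

coin-tail : ∀ n → Σ< (suc n) (λ j → coinDist 0 (suc j)) ≡ ½
coin-tail zero    = ℚ.+-identityˡ ½
coin-tail (suc n) = trans (cong (_+ 0ℚ) (coin-tail n)) (ℚ.+-identityʳ ½)

coin-tail-ZeroOr : ∀ n → ZeroOr (Σ< n (λ j → coinDist 0 (suc j))) ½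
coin-tail-ZeroOr zero    = inj₁ refl
coin-tail-ZeroOr (suc n) = inj₂ (coin-tail n)

module _ (f : PR (suc k)) (xs : Vec ℕ k) where

  μ-unfair : ∀ {e} → e ≢ 0 → (∀ n z → ZeroOrᶠ (⟦ f ⟧ n (xs ∷ʳ z)) (coinDist e)) →
             ∀ n i → ⟦ mu f ⟧ n xs i ≡ 0ℚ
  μ-unfair e≢0 unfair n i = x≡0⇒x*y≡0 (Π< i (λ z → Σ< n (λ j → ⟦ f ⟧ n (xs ∷ʳ z) (suc j)))) first≡0
    where
    first≡0 : ⟦ f ⟧ n (xs ∷ʳ i) 0 ≡ 0ℚ
    first≡0 with unfair n i
    ... | inj₁ f≗0    = f≗0 0
    ... | inj₂ f≗coin = trans (f≗coin 0) (coinDist-≢0 e≢0)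

  μ-ZeroOr-geometric : (∀ n z → ZeroOrᶠ (⟦ f ⟧ n (xs ∷ʳ z)) (coinDist 0)) →
                       ∀ n i → ZeroOr (⟦ mu f ⟧ n xs i) (½ * ½^ i)
  μ-ZeroOr-geometric fair n i = ZeroOr-* (ZeroOrᶠ-at (fair n i) 0) (Π<-ZeroOr i tail∼½)
    where
    tail∼½ : ∀ z → ZeroOr (Σ< n (λ j → ⟦ f ⟧ n (xs ∷ʳ z) (suc j))) ½
    tail∼½ z with fair n z
    ... | inj₁ f≗0    = inj₁ (Σ<-vanishing n λ j _ → f≗0 (suc j))
    ... | inj₂ f≗coin = ZeroOr-trans (inj₂ (Σ<-cong n λ j _ → f≗coin (suc j))) (coin-tail-ZeroOr n)

  μ-eventually-geometric : (∀ z → Eventually (λ n → ⟦ f ⟧ n (xs ∷ʳ z) ≗ coinDist 0)) →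
                           ∀ M → Eventually (λ n → ∀ i → i ℕ.< M → ⟦ mu f ⟧ n xs i ≡ ½ * ½^ i)
  μ-eventually-geometric fair M = eventually-map geometric (eventually-× (eventually-∀< fair M) (eventually-≥ 1))
    where
    geometric : ∀ {n} → (∀ z → z ℕ.< M → ⟦ f ⟧ n (xs ∷ʳ z) ≗ coinDist 0) × 1 ℕ.≤ n →
                ∀ i → i ℕ.< M → ⟦ mu f ⟧ n xs i ≡ ½ * ½^ i
    geometric {suc n} (f≗coin , _) i i<M = cong₂ _*_ (f≗coin i i<M 0) (Π<-cong i λ z z<i →
      trans (Σ<-cong (suc n) λ j _ → f≗coin z (ℕ.<-trans z<i i<M) (suc j)) (coin-tail n))

-- Vanishes exactly when b ≠ 0 and a ≤ b, i.e. when I2P (a / b) is a distribution.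
defect : ℕ → ℕ → ℕ
defect a b = (a ℕ.∸ b) ℕ.+ (1 ℕ.∸ b)

defect-valid : ∀ {a b} → a ℕ.≤ suc b → defect a (suc b) ≡ 0
defect-valid {b = b} a≤1+b = cong₂ ℕ._+_ (ℕ.m≤n⇒m∸n≡0 a≤1+b) (ℕ.0∸n≡0 b)

defect-0≢0 : ∀ a → defect a 0 ≢ 0
defect-0≢0 a = ℕ.1+n≢0 ∘ ℕ.m+n≡0⇒n≡0 a

defect-≰≢0 : ∀ {a b} → a ℕ.≰ b → defect a b ≢ 0
defect-≰≢0 a≰b = a≰b ∘ ℕ.m∸n≡0⇒m≤n ∘ ℕ.m+n≡0⇒m≡0 _

defectT : PR 1
defectT = comp plusT (comp monusT (unpair₁T ∷ unpair₂T ∷ []) ∷ comp monusT (comp succF (zeroF ∷ []) ∷ unpair₂T ∷ []) ∷ [])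

defectT-computes : Computes defectT (λ { (c ∷ []) → defect (unpair₁ c) (unpair₂ c) })
defectT-computes = Computes-ext
  (comp-computes plusT-computes
    (comp-computes monusT-computes (unpair₁T-computes ∷ unpair₂T-computes ∷ []) ∷
     comp-computes monusT-computes (comp-computes succF-computes (zeroF-computes ∷ []) ∷ unpair₂T-computes ∷ []) ∷ []))
  λ { (c ∷ []) → refl }

defectOf : ℕ → ℕ
defectOf c = defect (unpair₁ c) (unpair₂ c)

defectOf-pair : ∀ a b → defectOf (pair a b) ≡ defect a b
defectOf-pair a b = cong₂ defect (unpair₁-pair a b) (unpair₂-pair a b)

coinAtDefectT : PR 2
coinAtDefectT = comp coin (comp defectT (π (# 0) ∷ []) ∷ [])

coinAtDefect-ZeroOrᶠ : ∀ n c z → ZeroOrᶠ (⟦ coinAtDefectT ⟧ n (c ∷ z ∷ [])) (coinDist (defectOf c))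
coinAtDefect-ZeroOrᶠ n c z = comp-ZeroOrᶠ (comp-computes defectT-computes (π-computes (# 0) ∷ []) ∷ []) coin n (c ∷ z ∷ [])

coinAtDefect-eventually : ∀ c z → Eventually (λ n → ⟦ coinAtDefectT ⟧ n (c ∷ z ∷ []) ≗ coinDist (defectOf c))
coinAtDefect-eventually c z = comp-eventually (comp-computes defectT-computes (π-computes (# 0) ∷ []) ∷ []) coin (c ∷ z ∷ [])

geometricT : PR 1
geometricT = mu coinAtDefectT

i2pT : PR 1
i2pT = comp digitT (π (# 0) ∷ geometricT ∷ [])

weightedDigits : ℕ → ℕ → ℕ → ℚ
weightedDigits n c y = Σ< n (λ i → ⟦ geometricT ⟧ n (c ∷ []) i * ⟦ digitT ⟧ n (c ∷ i ∷ []) y)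

i2pT-ZeroOr : ∀ n c y → ZeroOr (⟦ i2pT ⟧ n (c ∷ []) y) (weightedDigits n c y)
i2pT-ZeroOr n c = ZeroOrᶠ-at (Σ<-ZeroOrᶠ n (λ z y → Σ< n (λ i → ⟦ geometricT ⟧ n (c ∷ []) i * ⟦ digitT ⟧ n (z ∷ i ∷ []) y))
                                         (inj₂ λ _ → refl))

i2pT-eventually : ∀ c y → Eventually (λ n → ⟦ i2pT ⟧ n (c ∷ []) y ≡ weightedDigits n c y)
i2pT-eventually c y = eventually-map (Σ<-dirac _ _ (λ _ → refl)) (eventually-≥ (suc c))

i2pT-invalid : ∀ a b → defect a b ≢ 0 → ∀ y → Approaches (λ n → ⟦ i2pT ⟧ n (pair a b ∷ []) y) 0ℚ
i2pT-invalid a b defect≢0 y = Approaches-0 λ n → [ id , (λ i2p≡Σ → trans i2p≡Σ (weightedDigits≡0 n)) ]′ (i2pT-ZeroOr n c y)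
  where
  c : ℕ
  c = pair a b
  unfair : ∀ n z → ZeroOrᶠ (⟦ coinAtDefectT ⟧ n (c ∷ z ∷ [])) (coinDist (defect a b))
  unfair n z = subst (λ e → ZeroOrᶠ (⟦ coinAtDefectT ⟧ n (c ∷ z ∷ [])) (coinDist e)) (defectOf-pair a b)
                     (coinAtDefect-ZeroOrᶠ n c z)
  weightedDigits≡0 : ∀ n → weightedDigits n c y ≡ 0ℚ
  weightedDigits≡0 n = Σ<-vanishing n λ i _ →
    x≡0⇒x*y≡0 (⟦ digitT ⟧ n (c ∷ i ∷ []) y) (μ-unfair coinAtDefectT (c ∷ []) defect≢0 unfair n i)

module _ (a b : ℕ) (a≤1+b : a ℕ.≤ suc b) where
  open BinaryExpansion a b a≤1+b

  private
    c : ℕ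
    c = pair a (suc b)

    defect≡0 : defectOf c ≡ 0
    defect≡0 = trans (defectOf-pair a (suc b)) (defect-valid a≤1+b)

    digit-pair : ∀ i → bit (unpair₂ c) (remainder (unpair₁ c) (unpair₂ c) i) ≡ digit i
    digit-pair i = cong₂ (λ a′ B′ → bit B′ (remainder a′ B′ i)) (unpair₁-pair a (suc b)) (unpair₂-pair a (suc b))

    fair : ∀ n z → ZeroOrᶠ (⟦ coinAtDefectT ⟧ n (c ∷ z ∷ [])) (coinDist 0)
    fair n z = subst (λ e → ZeroOrᶠ (⟦ coinAtDefectT ⟧ n (c ∷ z ∷ [])) (coinDist e)) defect≡0 (coinAtDefect-ZeroOrᶠ n c z)

    fair-eventually : ∀ z → Eventually (λ n → ⟦ coinAtDefectT ⟧ n (c ∷ z ∷ []) ≗ coinDist 0)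
    fair-eventually z = subst (λ e → Eventually (λ n → ⟦ coinAtDefectT ⟧ n (c ∷ z ∷ []) ≗ coinDist e)) defect≡0
                              (coinAtDefect-eventually c z)

    digit-DiracOrZero : ∀ n i → DiracOrZero (⟦ digitT ⟧ n (c ∷ i ∷ [])) (digit i)
    digit-DiracOrZero n i = subst (DiracOrZero _) (digit-pair i) (zeroOr-dirac digitT-computes n (c ∷ i ∷ []))

    digit-eventually : ∀ i → Eventually (λ n → ⟦ digitT ⟧ n (c ∷ i ∷ []) ≗ dirac (digit i))
    digit-eventually i = subst (λ v → Eventually (λ n → ⟦ digitT ⟧ n (c ∷ i ∷ []) ≗ dirac v)) (digit-pair i)
                               (eventually-dirac digitT-computes (c ∷ i ∷ []))

    summand : ℕ → ℕ → ℕ → ℚ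
    summand n y i = ⟦ geometricT ⟧ n (c ∷ []) i * ⟦ digitT ⟧ n (c ∷ i ∷ []) y

    summand-ZeroOr : ∀ y n i → ZeroOr (summand n y i) (term y i)
    summand-ZeroOr y n i = ZeroOr-* (μ-ZeroOr-geometric coinAtDefectT (c ∷ []) fair n i) (ZeroOrᶠ-at (digit-DiracOrZero n i) y)

    summand-eventually : ∀ y M → Eventually (λ n → ∀ i → i ℕ.< M → summand n y i ≡ term y i)
    summand-eventually y M =
      eventually-map (λ (geometric , digit≗δ) i i<M → cong₂ _*_ (geometric i i<M) (digit≗δ i i<M y))
        (eventually-× (μ-eventually-geometric coinAtDefectT (c ∷ []) fair-eventually M) (eventually-∀< digit-eventually M))

  i2pT-valid : ∀ y → Approaches (λ n → ⟦ i2pT ⟧ n (pair a (suc b) ∷ []) y) (bernoulli p y)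
  i2pT-valid y = Approaches-ZeroOr
    (Σ<-approaches (term-nonneg y) (summand-ZeroOr y) (summand-eventually y) (series-SupIs y))
    (proj₁ (bernoulli-bounds (ρ-nonneg 0) (ρ≤1 0) y))
    (λ n → i2pT-ZeroOr n c y) (i2pT-eventually c y)

i2pT-approaches : ∀ a b y → Approaches (λ n → ⟦ i2pT ⟧ n (pair a b ∷ []) y) (I2P a b y)
i2pT-approaches a zero y = i2pT-invalid a 0 (defect-0≢0 a) y
i2pT-approaches a (suc b) y with a ℕ.≤? suc b
... | yes a≤1+b = subst (Approaches _) (sym (I2P-valid a≤1+b y)) (i2pT-valid a b a≤1+b y)
... | no  a≰1+b = subst (Approaches _) (sym (I2P-invalid a≰1+b y)) (i2pT-invalid a (suc b) (defect-≰≢0 a≰1+b) y)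

proposition2 : Σ (PR 1) λ t → ∀ (a b y : ℕ) → t ⟨ pair a b ∷ [] , y ⟩≈ I2P a b y
proposition2 = i2pT , λ a b y → Approaches⇒SupIs (i2pT-approaches a b y)
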